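{- Let $G\mathcal{ECQ}$ be the calculus $G\mathcal{B}$ extended by Explosive Cut. Then Limited Cut is antiadmissible in $G\mathcal{ECQ}$: for every set $S$ of sequents, if the empty sequent $\emptyset\vartriangleright\emptyset$ is derivable from $S$ in $G\mathcal{ECQ}$ extended by Limited Cut, then it is derivable from $S$ in $G\mathcal{ECQ}$.
   Context: Formulas are built from atoms using $\wedge,\vee,{ - },\top,\bot$; a sequent $\Gamma\vartriangleright\Delta$ is a pair of finite multisets of formulas. The calculus $G\mathcal{B}$ consists of: introduction rules (from $\Gamma\vartriangleright\Delta,\varphi$ and $\Gamma\vartriangleright\Delta,\psi$ infer $\Gamma\vartriangleright\Delta,\varphi\wedge\psi$; from $\varphi,\psi,\Gamma\vartriangleright\Delta$ infer $\varphi\wedge\psi,\Gamma\vartriangleright\Delta$; from $\varphi,\Gamma\vartriangleright\Delta$ and $\psi,\Gamma\vartriangleright\Delta$ infer $\varphi\vee\psi,\Gamma\vartriangleright\Delta$; from $\Gamma\vartriangleright\Delta,\varphi,\psi$ infer $\Gamma\vartriangleright\Delta,\varphi\vee\psi$; from $\varphi,\Gamma\vartriangleright\Delta$ infer $\Gamma\vartriangleright\Delta,{ - }\varphi$; from $\Gamma\vartriangleright\Delta,\varphi$ infer ${ - }\varphi,\Gamma\vartriangleright\Delta$; axioms $\emptyset\vartriangleright\top$, $\bot\vartriangleright\emptyset$); elimination rules (the inverse of each of these two-way rules, e.g. from $\Gamma\vartriangleright\Delta,\varphi\wedge\psi$ infer $\Gamma\vartriangleright\Delta,\varphi$ and also $\Gamma\vartriangleright\Delta,\psi$;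 plus from $\top,\Gamma\vartriangleright\Delta$ infer $\Gamma\vartriangleright\Delta$ and from $\Gamma\vartriangleright\Delta,\bot$ infer $\Gamma\vartriangleright\Delta$); Weakening and Contraction on both sides. Explosive Cut: from $\emptyset\vartriangleright\varphi$ and $\varphi\vartriangleright\emptyset$ infer $\emptyset\vartriangleright\emptyset$. Limited Cut: from $\emptyset\vartriangleright\varphi$ and $\varphi,\Gamma\vartriangleright\Delta$ infer $\Gamma\vartriangleright\Delta$, and from $\Gamma\vartriangleright\Delta,\varphi$ and $\varphi\vartriangleright\emptyset$ infer $\Gamma\vartriangleright\Delta$. -}

module Defs where

open import Data.Nat using (ℕ)
open import Data.Bool using (Bool; true; false)
open import Data.List using (List; []; _∷_)
open import Data.List.Relation.Binary.Permutation.Propositional using (_↭_)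

data Fm : Set where
  atom : ℕ → Fm
  _∧̇_  : Fm → Fm → Fm
  _∨̇_  : Fm → Fm → Fm
  −_   : Fm → Fm
  ⊤̇    : Fm
  ⊥̇    : Fm

-- A sequent Γ ▷ Δ: finite multisets are represented as lists, taken up to
-- permutation via the Exchange rule below.  On the right, "Δ , φ" is
-- written φ ∷ Δ.
record Seq : Set where
  constructor _▷_
  field
    ant : List Fm
    suc : List Fm

-- The flag lc says whether Limited Cut is available.
data Der (S : Seq → Set) : Bool → Seq → Set where
  hyp   : ∀ {lc s} → S s → Der S lc s
  exch  : ∀ {lc Γ Γ' Δ Δ'} → Γ ↭ Γ' → Δ ↭ Δ' → Der S lc (Γ ▷ Δ) → Der S lc (Γ' ▷ Δ')
  ax⊤   : ∀ {lc} → Der S lc ([] ▷ (⊤̇ ∷ []))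
  ax⊥   : ∀ {lc} → Der S lc ((⊥̇ ∷ []) ▷ [])
  ∧R    : ∀ {lc Γ Δ φ ψ} → Der S lc (Γ ▷ (φ ∷ Δ)) → Der S lc (Γ ▷ (ψ ∷ Δ)) → Der S lc (Γ ▷ ((φ ∧̇ ψ) ∷ Δ))
  ∧L    : ∀ {lc Γ Δ φ ψ} → Der S lc ((φ ∷ ψ ∷ Γ) ▷ Δ) → Der S lc (((φ ∧̇ ψ) ∷ Γ) ▷ Δ)
  ∨L    : ∀ {lc Γ Δ φ ψ} → Der S lc ((φ ∷ Γ) ▷ Δ) → Der S lc ((ψ ∷ Γ) ▷ Δ) → Der S lc (((φ ∨̇ ψ) ∷ Γ) ▷ Δ)
  ∨R    : ∀ {lc Γ Δ φ ψ} → Der S lc (Γ ▷ (φ ∷ ψ ∷ Δ)) → Der S lc (Γ ▷ ((φ ∨̇ ψ) ∷ Δ))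
  −R    : ∀ {lc Γ Δ φ} → Der S lc ((φ ∷ Γ) ▷ Δ) → Der S lc (Γ ▷ ((− φ) ∷ Δ))
  −L    : ∀ {lc Γ Δ φ} → Der S lc (Γ ▷ (φ ∷ Δ)) → Der S lc (((− φ) ∷ Γ) ▷ Δ)
  -- elimination rules (inverses of the two-way rules)
  ∧R-e₁ : ∀ {lc Γ Δ φ ψ} → Der S lc (Γ ▷ ((φ ∧̇ ψ) ∷ Δ)) → Der S lc (Γ ▷ (φ ∷ Δ))
  ∧R-e₂ : ∀ {lc Γ Δ φ ψ} → Der S lc (Γ ▷ ((φ ∧̇ ψ) ∷ Δ)) → Der S lc (Γ ▷ (ψ ∷ Δ))
  ∧L-e  : ∀ {lc Γ Δ φ ψ} → Der S lc (((φ ∧̇ ψ) ∷ Γ) ▷ Δ) → Der S lc ((φ ∷ ψ ∷ Γ) ▷ Δ)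
  ∨L-e₁ : ∀ {lc Γ Δ φ ψ} → Der S lc (((φ ∨̇ ψ) ∷ Γ) ▷ Δ) → Der S lc ((φ ∷ Γ) ▷ Δ)
  ∨L-e₂ : ∀ {lc Γ Δ φ ψ} → Der S lc (((φ ∨̇ ψ) ∷ Γ) ▷ Δ) → Der S lc ((ψ ∷ Γ) ▷ Δ)
  ∨R-e  : ∀ {lc Γ Δ φ ψ} → Der S lc (Γ ▷ ((φ ∨̇ ψ) ∷ Δ)) → Der S lc (Γ ▷ (φ ∷ ψ ∷ Δ))
  −R-e  : ∀ {lc Γ Δ φ} → Der S lc (Γ ▷ ((− φ) ∷ Δ)) → Der S lc ((φ ∷ Γ) ▷ Δ)
  −L-e  : ∀ {lc Γ Δ φ} → Der S lc (((− φ) ∷ Γ) ▷ Δ) → Der S lc (Γ ▷ (φ ∷ Δ))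
  ⊤L-e  : ∀ {lc Γ Δ} → Der S lc ((⊤̇ ∷ Γ) ▷ Δ) → Der S lc (Γ ▷ Δ)
  ⊥R-e  : ∀ {lc Γ Δ} → Der S lc (Γ ▷ (⊥̇ ∷ Δ)) → Der S lc (Γ ▷ Δ)
  WL    : ∀ {lc Γ Δ φ} → Der S lc (Γ ▷ Δ) → Der S lc ((φ ∷ Γ) ▷ Δ)
  WR    : ∀ {lc Γ Δ φ} → Der S lc (Γ ▷ Δ) → Der S lc (Γ ▷ (φ ∷ Δ))
  CL    : ∀ {lc Γ Δ φ} → Der S lc ((φ ∷ φ ∷ Γ) ▷ Δ) → Der S lc ((φ ∷ Γ) ▷ Δ)
  CR    : ∀ {lc Γ Δ φ} → Der S lc (Γ ▷ (φ ∷ φ ∷ Δ)) → Der S lc (Γ ▷ (φ ∷ Δ))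
  ecut  : ∀ {lc φ} → Der S lc ([] ▷ (φ ∷ [])) → Der S lc ((φ ∷ []) ▷ []) → Der S lc ([] ▷ [])
  lcutL : ∀ {Γ Δ φ} → Der S true ([] ▷ (φ ∷ [])) → Der S true ((φ ∷ Γ) ▷ Δ) → Der S true (Γ ▷ Δ)
  lcutR : ∀ {Γ Δ φ} → Der S true (Γ ▷ (φ ∷ Δ)) → Der S true ((φ ∷ []) ▷ []) → Der S true (Γ ▷ Δ)

GECQ : (Seq → Set) → Seq → Set
GECQ S = Der S false

GECQ+LC : (Seq → Set) → Seq → Set
GECQ+LC S = Der S true

-- Limited Cut with cut formula φ can be traded for an extra antecedent that
-- is a theorem of GECQ (the left cut, via φ ∨ (A ⊃ B)) or an extra succedent
-- that is refutable in GECQ (the right cut, via φ ∧ −(A ⊃ B)), where A ▷ B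
-- collects the theorems and refutations the premisses already depend on.
-- Hence every sequent Γ ▷ Δ derivable with Limited Cut has a GECQ derivation
-- of Γ, A ▷ Δ, B with A provable and B refutable.  For the empty sequent this
-- is A ▷ B, so A ⊃ B is both provable and refutable, and Explosive Cut
-- yields ∅ ▷ ∅.
module Submission where

open import Data.Bool using (true)
open import Data.List using (List; []; _∷_; _++_; [_])
open import Data.List.Properties using (++-identityʳ)
open import Data.List.Relation.Binary.Permutation.Propositional
  using (_↭_; ↭-refl; ↭-reflexive; ↭-sym; prep; swap)
open import Data.List.Relation.Binary.Permutation.Propositional.Properties
  using (++-comm; ++⁺ʳ)

open import Defs

_⊃_ : Fm → Fm → Fm
φ ⊃ ψ = (− φ) ∨̇ ψ

module _ {S : Seq → Set} where

  infix 4 _⊢_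

  _⊢_ : List Fm → List Fm → Set
  Γ ⊢ Δ = GECQ S (Γ ▷ Δ)

  Provable Refutable : Fm → Set
  Provable φ  = [] ⊢ [ φ ]
  Refutable φ = [ φ ] ⊢ []

  last↭head : ∀ (Γ : List Fm) φ → Γ ++ [ φ ] ↭ φ ∷ Γ
  last↭head Γ φ = ++-comm Γ [ φ ]

  swapˡ : ∀ {φ ψ Γ Δ} → (φ ∷ ψ ∷ Γ) ⊢ Δ → (ψ ∷ φ ∷ Γ) ⊢ Δ
  swapˡ = exch (swap _ _ ↭-refl) ↭-refl

  swapʳ : ∀ {φ ψ Γ Δ} → Γ ⊢ (φ ∷ ψ ∷ Δ) → Γ ⊢ (ψ ∷ φ ∷ Δ)
  swapʳ = exch ↭-refl (swap _ _ ↭-refl)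

  lastˡ : ∀ {φ Γ Δ} → (φ ∷ Γ) ⊢ Δ → (Γ ++ [ φ ]) ⊢ Δ
  lastˡ {φ} {Γ} = exch (↭-sym (last↭head Γ φ)) ↭-refl

  lastʳ : ∀ {φ Γ Δ} → Γ ⊢ (φ ∷ Δ) → Γ ⊢ (Δ ++ [ φ ])
  lastʳ {φ} {Δ = Δ} = exch ↭-refl (↭-sym (last↭head Δ φ))

  onLast : ∀ {A A' B B' Γ Δ} →
           ((A ∷ Γ) ⊢ (B ∷ Δ) → (A' ∷ Γ) ⊢ (B' ∷ Δ)) →
           (Γ ++ [ A ]) ⊢ (Δ ++ [ B ]) → (Γ ++ [ A' ]) ⊢ (Δ ++ [ B' ])
  onLast {A} {B = B} {Γ = Γ} {Δ} f d =
    lastˡ (lastʳ (f (exch (last↭head Γ A) (last↭head Δ B) d)))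

  weakenˡ : ∀ Γ {Γ₀ Δ} → Γ₀ ⊢ Δ → (Γ ++ Γ₀) ⊢ Δ
  weakenˡ []      d = d
  weakenˡ (_ ∷ Γ) d = WL (weakenˡ Γ d)

  weakenʳ : ∀ Δ {Γ Δ₀} → Γ ⊢ Δ₀ → Γ ⊢ (Δ ++ Δ₀)
  weakenʳ []      d = d
  weakenʳ (_ ∷ Δ) d = WR (weakenʳ Δ d)

  Provable⇒⊢ : ∀ {φ Γ Δ} → Provable φ → Γ ⊢ (φ ∷ Δ)
  Provable⇒⊢ {φ} {Γ} {Δ} p =
    exch (↭-reflexive (++-identityʳ Γ)) (++-comm Δ [ φ ]) (weakenˡ Γ (weakenʳ Δ p))

  Refutable⇒⊢ : ∀ {φ Γ Δ} → Refutable φ → (φ ∷ Γ) ⊢ Δ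
  Refutable⇒⊢ {φ} {Γ} {Δ} r =
    exch (++-comm Γ [ φ ]) (↭-reflexive (++-identityʳ Δ)) (weakenˡ Γ (weakenʳ Δ r))

  ∧-weakenˡ : ∀ {A A' Γ Δ} → (A ∷ Γ) ⊢ Δ → ((A ∧̇ A') ∷ Γ) ⊢ Δ
  ∧-weakenˡ d = ∧L (swapˡ (WL d))

  ∧-weakenʳ : ∀ {A A' Γ Δ} → (A' ∷ Γ) ⊢ Δ → ((A ∧̇ A') ∷ Γ) ⊢ Δ
  ∧-weakenʳ d = ∧L (WL d)

  ∨-weakenˡ : ∀ {B B' Γ Δ} → Γ ⊢ (B ∷ Δ) → Γ ⊢ ((B ∨̇ B') ∷ Δ)
  ∨-weakenˡ d = ∨R (swapʳ (WR d))

  ∨-weakenʳ : ∀ {B B' Γ Δ} → Γ ⊢ (B' ∷ Δ) → Γ ⊢ ((B ∨̇ B') ∷ Δ)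
  ∨-weakenʳ d = ∨R (WR d)

  ⊃R : ∀ {A B Γ Δ} → (A ∷ Γ) ⊢ (B ∷ Δ) → Γ ⊢ ((A ⊃ B) ∷ Δ)
  ⊃R d = ∨R (−R d)

  ⊃-refutable : ∀ {A B} → Provable A → Refutable B → Refutable (A ⊃ B)
  ⊃-refutable p r = ∨L (−L p) r

  data Modulo (Γ Δ : List Fm) : Set where
    modulo : ∀ {A B} → Provable A → Refutable B →
             (Γ ++ [ A ]) ⊢ (Δ ++ [ B ]) → Modulo Γ Δ

  Modulo-pure : ∀ {Γ Δ} → Γ ⊢ Δ → Modulo Γ Δ
  Modulo-pure d = modulo ax⊤ ax⊥ (lastˡ (WL (lastʳ (WR d))))

  Modulo-map : ∀ {Γ Δ Γ' Δ'} →
               (∀ {A B} → (Γ ++ [ A ]) ⊢ (Δ ++ [ B ]) → (Γ' ++ [ A ]) ⊢ (Δ' ++ [ B ])) →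
               Modulo Γ Δ → Modulo Γ' Δ'
  Modulo-map f (modulo p r d) = modulo p r (f d)

  Modulo-zipWith : ∀ {Γ₁ Δ₁ Γ₂ Δ₂ Γ Δ} →
                   (∀ {A B} → (Γ₁ ++ [ A ]) ⊢ (Δ₁ ++ [ B ]) → (Γ₂ ++ [ A ]) ⊢ (Δ₂ ++ [ B ]) →
                              (Γ ++ [ A ]) ⊢ (Δ ++ [ B ])) →
                   Modulo Γ₁ Δ₁ → Modulo Γ₂ Δ₂ → Modulo Γ Δ
  Modulo-zipWith f (modulo p₁ r₁ d₁) (modulo p₂ r₂ d₂) =
    modulo (∧R p₁ p₂) (∨L r₁ r₂)
      (f (onLast (λ d → ∧-weakenˡ (∨-weakenˡ d)) d₁)
         (onLast (λ d → ∧-weakenʳ (∨-weakenʳ d)) d₂))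

  Modulo-lcutˡ : ∀ {φ Γ Δ} → Modulo [] [ φ ] → Modulo (φ ∷ Γ) Δ → Modulo Γ Δ
  Modulo-lcutˡ {φ} {Γ} {Δ} (modulo {A₁} {B₁} p₁ r₁ d₁) (modulo {A₂} {B₂} p₂ r₂ d₂) =
    modulo (∧R φ∨[A₁⊃B₁]-provable p₂) r₂
      (lastˡ (∧L (∨L φ-case (Refutable⇒⊢ (⊃-refutable p₁ r₁)))))
    where
    φ∨[A₁⊃B₁]-provable : Provable (φ ∨̇ (A₁ ⊃ B₁))
    φ∨[A₁⊃B₁]-provable = ∨R (swapʳ (⊃R (swapʳ d₁)))

    φ-case : (φ ∷ A₂ ∷ Γ) ⊢ (Δ ++ [ B₂ ])
    φ-case = exch (prep φ (last↭head Γ A₂)) ↭-refl d₂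

  Modulo-lcutʳ : ∀ {φ Γ Δ} → Modulo Γ (φ ∷ Δ) → Modulo [ φ ] [] → Modulo Γ Δ
  Modulo-lcutʳ {φ} {Δ = Δ} (modulo {B = B₁} p₁ r₁ d₁) (modulo {A₂} {B₂} p₂ r₂ d₂) =
    modulo p₁ (∨L φ∧−[A₂⊃B₂]-refutable r₁)
      (lastʳ (∨R (exch ↭-refl (prep _ (last↭head Δ B₁))
                  (∧R d₁ (Provable⇒⊢ (−R (⊃-refutable p₂ r₂)))))))
    where
    φ∧−[A₂⊃B₂]-refutable : Refutable (φ ∧̇ (− (A₂ ⊃ B₂)))
    φ∧−[A₂⊃B₂]-refutable = ∧L (swapˡ (−L (⊃R (swapˡ d₂))))

  lcut-elim : ∀ {Γ Δ} → Der S true (Γ ▷ Δ) → Modulo Γ Δ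
  lcut-elim (hyp s)     = Modulo-pure (hyp s)
  lcut-elim (exch p q d) = Modulo-map (exch (++⁺ʳ _ p) (++⁺ʳ _ q)) (lcut-elim d)
  lcut-elim ax⊤         = Modulo-pure ax⊤
  lcut-elim ax⊥         = Modulo-pure ax⊥
  lcut-elim (∧R d e)    = Modulo-zipWith ∧R (lcut-elim d) (lcut-elim e)
  lcut-elim (∧L d)      = Modulo-map ∧L (lcut-elim d)
  lcut-elim (∨L d e)    = Modulo-zipWith ∨L (lcut-elim d) (lcut-elim e)
  lcut-elim (∨R d)      = Modulo-map ∨R (lcut-elim d)
  lcut-elim (−R d)      = Modulo-map −R (lcut-elim d)
  lcut-elim (−L d)      = Modulo-map −L (lcut-elim d)
  lcut-elim (∧R-e₁ d)   = Modulo-map ∧R-e₁ (lcut-elim d)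
  lcut-elim (∧R-e₂ d)   = Modulo-map ∧R-e₂ (lcut-elim d)
  lcut-elim (∧L-e d)    = Modulo-map ∧L-e (lcut-elim d)
  lcut-elim (∨L-e₁ d)   = Modulo-map ∨L-e₁ (lcut-elim d)
  lcut-elim (∨L-e₂ d)   = Modulo-map ∨L-e₂ (lcut-elim d)
  lcut-elim (∨R-e d)    = Modulo-map ∨R-e (lcut-elim d)
  lcut-elim (−R-e d)    = Modulo-map −R-e (lcut-elim d)
  lcut-elim (−L-e d)    = Modulo-map −L-e (lcut-elim d)
  lcut-elim (⊤L-e d)    = Modulo-map ⊤L-e (lcut-elim d)
  lcut-elim (⊥R-e d)    = Modulo-map ⊥R-e (lcut-elim d)
  lcut-elim (WL d)      = Modulo-map WL (lcut-elim d)
  lcut-elim (WR d)      = Modulo-map WR (lcut-elim d)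
  lcut-elim (CL d)      = Modulo-map CL (lcut-elim d)
  lcut-elim (CR d)      = Modulo-map CR (lcut-elim d)
  lcut-elim (ecut d e)  = Modulo-lcutˡ (lcut-elim d) (lcut-elim e)
  lcut-elim (lcutL d e) = Modulo-lcutˡ (lcut-elim d) (lcut-elim e)
  lcut-elim (lcutR d e) = Modulo-lcutʳ (lcut-elim d) (lcut-elim e)

  Modulo-explode : Modulo [] [] → [] ⊢ []
  Modulo-explode (modulo p r d) = ecut (⊃R d) (⊃-refutable p r)

proposition3p12 : (S : Seq → Set) → GECQ+LC S ([] ▷ []) → GECQ S ([] ▷ [])
proposition3p12 S d = Modulo-explode (lcut-elim d)
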